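{- Let $H$ and $G$ be graphs, with $\delta=\delta(G)\geq 1$ and $n=|V(H)|$. Assume that either (a) $G\cong K_{\delta+1}$ and it is not the case that $\delta\geq 3$ and $n=k\delta$ for some integer $k\geq 3$; or (b) $G\not\cong K_{\delta+1}$ and $H$ is $G$-free critical. Then (I) $\chi_G(H)+\chi_G(\overline{H})\leq \left\lceil \frac{n}{\delta}\right\rceil+1$; (II) this bound is sharp, i.e., there exist graphs $H,G$ satisfying the hypotheses for which equality holds.
   Context: All graphs are finite and simple; $G$ has order at least $2$. A copy of $G$ in $H$ is a subgraph of $H$ isomorphic to $G$. A $G$-free $k$-coloring of $H$ is a map $\pi:V(H)\to\{1,\dots,k\}$ such that each induced subgraph $H[\pi^{ -1}(i)]$ contains no copy of $G$; $\chi_G(H)$ is the least $k$ for which such a coloring exists. A graph $H$ with $\chi_G(H)=k$ is $G$-free critical ($G$-free $k$-critical) if every proper subgraph $H'$ of $H$ satisfies $\chi_G(H')\leq k-1$. $\overline{H}$ is the complement of $H$, $\delta(\cdot)$ the minimum degree, $K_m$ the complete graph on $m$ vertices. -}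

module Defs where

open import Data.Nat using (ℕ; zero; suc; _+_; _*_; _∸_; _≤_; _<_; _≥_)
open import Data.Nat.DivMod using (_/_)
open import Data.Bool using (Bool; true; false; not; if_then_else_)
open import Data.Fin using (Fin)
open import Data.List using (List; map; allFin)
open import Data.Nat.ListAction using (sum)
open import Data.Product using (Σ; ∃; _×_; _,_)
open import Data.Empty using (⊥)
open import Data.Sum using (_⊎_)
open import Relation.Nullary using (¬_)
open import Relation.Binary.PropositionalEquality using (_≡_; _≢_)
open import Function.Definitions using (Injective; Surjective)

record Graph (n : ℕ) : Set where
  field
    adj    : Fin n → Fin n → Bool
    sym    : ∀ u v → adj u v ≡ adj v u
    irrefl : ∀ v → adj v v ≡ false

complement : ∀ {n} → Graph n → Graph n
complement {n} H = record
  { adj    = λ u v → adjC u v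
  ; sym    = symC
  ; irrefl = irrC
  }
  where
  open import Data.Fin using (_≟_)
  open import Relation.Nullary using (yes; no)
  open import Relation.Binary.PropositionalEquality using (refl; sym; cong)
  open import Data.Empty using (⊥-elim)
  adjC : Fin n → Fin n → Bool
  adjC u v with u ≟ v
  ... | yes _ = false
  ... | no  _ = not (Graph.adj H u v)
  symC : ∀ u v → adjC u v ≡ adjC v u
  symC u v with u ≟ v | v ≟ u
  ... | yes _ | yes _ = refl
  ... | yes p | no ¬q = ⊥-elim (¬q (sym p))
  ... | no ¬p | yes q = ⊥-elim (¬p (sym q))
  ... | no _  | no _  = cong not (Graph.sym H u v)
  irrC : ∀ v → adjC v v ≡ false
  irrC v with v ≟ v
  ... | yes _ = refl
  ... | no ¬p = ⊥-elim (¬p refl)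

complete : (m : ℕ) → Graph m
complete m = complement emptyG
  where
  emptyG : Graph m
  emptyG = record { adj = λ _ _ → false ; sym = λ _ _ → _≡_.refl ; irrefl = λ _ → _≡_.refl }

Iso : ∀ {m m'} → Graph m → Graph m' → Set
Iso {m} {m'} G G' =
  Σ (Fin m → Fin m') λ f →
    Injective _≡_ _≡_ f × Surjective _≡_ _≡_ f ×
    (∀ u v → Graph.adj G' (f u) (f v) ≡ Graph.adj G u v)

degree : ∀ {m} → Graph m → Fin m → ℕ
degree {m} G v = sum (map (λ u → if Graph.adj G v u then 1 else 0) (allFin m))

IsMinDegree : ∀ {m} → Graph m → ℕ → Set
IsMinDegree {m} G d = (∃ λ v → degree G v ≡ d) × (∀ v → d ≤ degree G v)

-- A copy of G in H: an injective map V(G) → V(H) sending edges to edges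
-- (i.e. a subgraph of H isomorphic to G).  It lies inside the colour class c
-- of π if all its vertices get colour c.
CopyIn : ∀ {m n} → Graph m → Graph n → (Fin n → Set) → Set
CopyIn {m} {n} G H inClass =
  Σ (Fin m → Fin n) λ f →
    Injective _≡_ _≡_ f ×
    (∀ u v → Graph.adj G u v ≡ true → Graph.adj H (f u) (f v) ≡ true) ×
    (∀ u → inClass (f u))

GFreeColoring : ∀ {m n} → Graph m → Graph n → (k : ℕ) → (Fin n → Fin k) → Set
GFreeColoring G H k π = ∀ (c : Fin _) → ¬ CopyIn G H (λ v → π v ≡ c)

Colorable : ∀ {m n} → Graph m → Graph n → ℕ → Set
Colorable {n = n} G H k = Σ (Fin n → Fin k) λ π → GFreeColoring G H k π

IsChi : ∀ {m n} → Graph m → Graph n → ℕ → Set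
IsChi G H k = Colorable G H k × (∀ j → j < k → ¬ Colorable G H j)

-- H' (on Fin m', embedded via e) is a subgraph of H.
-- It is proper unless e is onto and every edge of H comes from an edge of H'.
ProperSubgraph : ∀ {n m'} → Graph n → Graph m' → Set
ProperSubgraph {n} {m'} H H' =
  Σ (Fin m' → Fin n) λ e →
    Injective _≡_ _≡_ e ×
    (∀ i j → Graph.adj H' i j ≡ true → Graph.adj H (e i) (e j) ≡ true) ×
    ¬ (Surjective _≡_ _≡_ e ×
       (∀ i j → Graph.adj H (e i) (e j) ≡ true → Graph.adj H' i j ≡ true))

Critical : ∀ {m n} → Graph m → Graph n → Set
Critical G H =
  Σ ℕ λ k → IsChi G H k ×
    (∀ m' (H' : Graph m') → ProperSubgraph H H' → ∀ j → IsChi G H' j → j ≤ k ∸ 1)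

-- ⌈ n / d ⌉ for d ≥ 1 (value at d = 0 is irrelevant: 0).
ceilDiv : ℕ → ℕ → ℕ
ceilDiv n zero    = 0
ceilDiv n (suc d) = (n + d) / suc d

Hyp : ∀ {m n} → Graph m → Graph n → ℕ → Set
Hyp {m} {n} G H δ =
  2 ≤ m × IsMinDegree G δ × 1 ≤ δ ×
  ( (Iso G (complete (suc δ)) ×
       ¬ (3 ≤ δ × Σ ℕ λ k → 3 ≤ k × n ≡ k * δ))
  ⊎ (¬ Iso G (complete (suc δ)) × Critical G H))

-- Let χ₁ = χ_G(H) = k + 1 and δ = δ(G).  A vertex set S of H that is critical for G-free
-- k-colourings has more than kδ vertices, each with at least kδ neighbours in S: if a vertex v
-- had fewer than δ neighbours of some colour c in a colouring of S - v, colouring v with c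
-- would give a G-free colouring of S.  Colour the complement greedily, putting the vertices
-- of S last: every vertex then has at most n - 1 - kδ earlier neighbours in the complement, so
-- some colour class among ⌊(n - 1 - kδ)/δ⌋ + 1 colours contains fewer than δ of them, and a
-- class in which every vertex has fewer than δ earlier neighbours contains no copy of G
-- (look at the last vertex of the copy).  Hence χ₁ + χ_G(H̄) ≤ k + 1 + ⌊(n - 1)/δ⌋ - k + 1,
-- which is ⌈n/δ⌉ + 1.
module Submission where

open import Defs
open import Data.Nat using (ℕ; zero; suc; _+_; _*_; _∸_; _≤_; _<_; z≤n; s≤s; _<ᵇ_; _≤?_; _<?_; NonZero)
  renaming (_≟_ to _≟ℕ_)
open import Data.Nat.Properties hiding (_≟_; suc-injective; 0≢1+n)
open import Data.Nat.DivMod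
  using (_/_; _%_; m≡m%n+[m/n]*n; m%n<n; m/n≡1+[m∸n]/n; /-monoˡ-≤; m*n/n≡m; [m∸n*o]/o≡m/o∸n)
open import Data.Nat.ListAction using () renaming (sum to sumᴸ)
open import Algebra.Properties.CommutativeMonoid.Sum +-0-commutativeMonoid
  using (sum; sum-syntax; ∑-comm; ∑-distrib-+; sum-cong-≗)
open import Data.Bool using (Bool; true; false; not; _∧_; if_then_else_)
open import Data.Bool.Properties
  using (∧-identityʳ; ∧-zeroʳ; ∧-conicalˡ; ∧-conicalʳ; ∧-inverseʳ; ¬-not; T-≡) renaming (_≟_ to _≟ᵇ_)
open import Data.Fin using (Fin; zero; suc; toℕ; _↑ˡ_; _↑ʳ_)
open import Data.Fin.Properties
  using (_≟_; any?; pigeonhole; suc-injective; 0≢1+n; toℕ-injective; toℕ<n;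
         toℕ-↑ˡ; toℕ-↑ʳ; ↑ˡ-injective; ↑ʳ-injective)
open import Data.List using (List; []; _∷_; tabulate; allFin)
open import Data.List.Properties using (map-tabulate)
open import Data.List.Membership.Propositional using (_∈_)
open import Data.List.Membership.Propositional.Properties using (∈-allFin)
open import Data.List.Relation.Unary.Any using (here; there)
import Data.List.Relation.Unary.All as All
open import Data.List.Extrema.Nat using (argmax; f[xs]≤f[argmax])
open import Data.Vec.Functional using (updateAt)
open import Data.Vec.Functional.Properties using (updateAt-updates; updateAt-minimal)
open import Data.Product using (Σ; ∃; _×_; _,_; proj₁; proj₂)
open import Data.Sum using (inj₁)
open import Function using (_∘_; const; id; Equivalence)
open import Function.Definitions using (Injective)
open import Relation.Nullary using (¬_; yes; no; contradiction)
open import Relation.Nullary.Decidable using (does; dec-true; dec-false; decidable-stable; ¬¬-excluded-middle)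
open import Relation.Nullary.Negation using (¬¬-map)
open import Relation.Binary.PropositionalEquality

open Graph using (adj; irrefl)

-- Counting on Fin k

fromBool : Bool → ℕ
fromBool b = if b then 1 else 0

count : ∀ {k} → (Fin k → Bool) → ℕ
count {k} P = ∑[ i < k ] fromBool (P i)

infixl 7 _∩_
_∩_ : ∀ {k} → (Fin k → Bool) → (Fin k → Bool) → Fin k → Bool
(P ∩ Q) i = P i ∧ Q i

infixl 7 _─_
_─_ : ∀ {k} → (Fin k → Bool) → Fin k → Fin k → Bool
(P ─ w) i = P i ∧ not (does (w ≟ i))

infix 4 _⊆_
_⊆_ : ∀ {k} → (Fin k → Bool) → (Fin k → Bool) → Set
P ⊆ Q = ∀ i → P i ≡ true → Q i ≡ true

colorClass : ∀ {k t} → (Fin k → Fin t) → Fin t → Fin k → Bool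
colorClass π c i = does (π i ≟ c)

∧-intro : ∀ {a b} → a ≡ true → b ≡ true → a ∧ b ≡ true
∧-intro refl refl = refl

─-⊆ : ∀ {k} (P : Fin k → Bool) w → P ─ w ⊆ P
─-⊆ P w i = ∧-conicalˡ (P i) _

─-mono : ∀ {k} {P Q : Fin k → Bool} w → P ⊆ Q → P ─ w ⊆ Q ─ w
─-mono {P = P} w P⊆Q i e = ∧-intro (P⊆Q i (∧-conicalˡ (P i) _ e)) (∧-conicalʳ (P i) _ e)

─-true : ∀ {k} {P : Fin k → Bool} {w i} → P i ≡ true → w ≢ i → (P ─ w) i ≡ true
─-true {w = w} {i} Pi w≢i = ∧-intro Pi (cong not (dec-false (w ≟ i) w≢i))

─-self : ∀ {k} (P : Fin k → Bool) w → (P ─ w) w ≡ false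
─-self P w rewrite dec-true (w ≟ w) refl = ∧-zeroʳ (P w)

sum-mono-≤ : ∀ {k} {f g : Fin k → ℕ} → (∀ i → f i ≤ g i) → sum f ≤ sum g
sum-mono-≤ {zero} f≤g = z≤n
sum-mono-≤ {suc k} f≤g = +-mono-≤ (f≤g zero) (sum-mono-≤ (f≤g ∘ suc))

sum-const : ∀ k c → ∑[ i < k ] c ≡ k * c
sum-const zero c = refl
sum-const (suc k) c = cong (c +_) (sum-const k c)

count-true : ∀ k → count {k} (const true) ≡ k
count-true k = trans (sum-const k 1) (*-identityʳ k)

count-false : ∀ {k} {P : Fin k → Bool} → (∀ i → P i ≡ false) → count P ≡ 0
count-false {k} P≡false =
  trans (sum-cong-≗ (cong fromBool ∘ P≡false)) (trans (sum-const k 0) (*-zeroʳ k))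

count-mono : ∀ {k} {P Q : Fin k → Bool} → P ⊆ Q → count P ≤ count Q
count-mono P⊆Q = sum-mono-≤ (λ i → fromBool-mono (P⊆Q i))
  where
  fromBool-mono : ∀ {a b} → (a ≡ true → b ≡ true) → fromBool a ≤ fromBool b
  fromBool-mono {false} _ = z≤n
  fromBool-mono {true} a⇒b rewrite a⇒b refl = ≤-refl

count-≤ : ∀ {k} (P : Fin k → Bool) → count P ≤ k
count-≤ {k} P = subst (count P ≤_) (count-true k) (count-mono {P = P} {Q = const true} (λ _ _ → refl))

count-not : ∀ {k} (P : Fin k → Bool) → count (not ∘ P) + count P ≡ k
count-not {k} P = begin
  count (not ∘ P) + count P                ≡⟨ ∑-distrib-+ (fromBool ∘ not ∘ P) (fromBool ∘ P) ⟨
  ∑[ i < k ] (fromBool (not (P i)) + fromBool (P i)) ≡⟨ sum-cong-≗ (λ i → not+id (P i)) ⟩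
  count {k} (const true)                   ≡⟨ count-true k ⟩
  k                                        ∎
  where
  open ≡-Reasoning
  not+id : ∀ b → fromBool (not b) + fromBool b ≡ 1
  not+id true = refl
  not+id false = refl

count-∩-cong : ∀ {k} {P Q Q′ : Fin k → Bool} → (∀ i → P i ≡ true → Q i ≡ Q′ i) →
               count (P ∩ Q) ≡ count (P ∩ Q′)
count-∩-cong {P = P} {Q} {Q′} Q≡Q′ = sum-cong-≗ (λ i → cong fromBool (pointwise i (P i) refl))
  where
  pointwise : ∀ i b → P i ≡ b → b ∧ Q i ≡ b ∧ Q′ i
  pointwise i false _ = refl
  pointwise i true Pi = Q≡Q′ i Pi

count-remove : ∀ {k} (P : Fin k → Bool) {w} → P w ≡ true → count P ≡ suc (count (P ─ w))
count-remove P {zero} Pw rewrite Pw =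
  cong suc (sum-cong-≗ (λ i → cong fromBool (sym (∧-identityʳ (P (suc i))))))
count-remove {suc k} P {suc w} Pw = begin
  fromBool (P zero) + count (P ∘ suc)
    ≡⟨ cong (fromBool (P zero) +_) (count-remove (P ∘ suc) Pw) ⟩
  fromBool (P zero) + suc (count (P ∘ suc ─ w))
    ≡⟨ +-suc _ _ ⟩
  suc (fromBool (P zero) + count (P ∘ suc ─ w))
    ≡⟨ cong (λ b → suc (fromBool b + count (P ∘ suc ─ w))) (∧-identityʳ (P zero)) ⟨
  suc (count (P ─ suc w)) ∎
  where open ≡-Reasoning

count-single : ∀ {k} (w : Fin k) → count (λ i → does (w ≟ i)) ≡ 1
count-single w =
  trans (count-remove (λ i → does (w ≟ i)) (dec-true (w ≟ w) refl))
        (cong suc (count-false (λ i → ∧-inverseʳ (does (w ≟ i)))))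

count-injective : ∀ {a b} (f : Fin a → Fin b) → Injective _≡_ _≡_ f →
                  {P : Fin a → Bool} {Q : Fin b → Bool} →
                  (∀ i → P i ≡ true → Q (f i) ≡ true) → count P ≤ count Q
count-injective {zero} f f-inj PQ = z≤n
count-injective {suc a} f f-inj {P} {Q} PQ with P zero in P₀
... | false = count-injective (f ∘ suc) (suc-injective ∘ f-inj) (PQ ∘ suc)
... | true = begin
  suc (count (P ∘ suc))    ≤⟨ s≤s (count-injective (f ∘ suc) (suc-injective ∘ f-inj) {Q = Q ─ f zero} into) ⟩
  suc (count (Q ─ f zero)) ≡⟨ count-remove Q (PQ zero P₀) ⟨
  count Q                  ∎
  where
  open ≤-Reasoning
  into : ∀ i → P (suc i) ≡ true → (Q ─ f zero) (f (suc i)) ≡ true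
  into i Pi = ─-true {P = Q} (PQ (suc i) Pi) (λ eq → 0≢1+n (f-inj eq))

count-partition : ∀ {k t} (P : Fin k → Bool) (π : Fin k → Fin t) →
                  count P ≡ ∑[ c < t ] count (P ∩ colorClass π c)
count-partition {t = t} P π =
  trans (sum-cong-≗ (λ i → split i (P i))) (∑-comm (λ i c → fromBool ((P ∩ colorClass π c) i)))
  where
  split : ∀ i b → fromBool b ≡ ∑[ c < t ] fromBool (b ∧ does (π i ≟ c))
  split i true = sym (count-single (π i))
  split i false = sym (count-false {t} {const false} (λ _ → refl))

count-≥-classes : ∀ {k t δ} (P : Fin k → Bool) (π : Fin k → Fin t) →
                  (∀ c → δ ≤ count (P ∩ colorClass π c)) → t * δ ≤ count P
count-≥-classes {t = t} {δ} P π large = begin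
  t * δ                                  ≡⟨ sum-const t δ ⟨
  ∑[ c < t ] δ                           ≤⟨ sum-mono-≤ large ⟩
  ∑[ c < t ] count (P ∩ colorClass π c)  ≡⟨ count-partition P π ⟨
  count P                                ∎
  where open ≤-Reasoning

pigeonhole-colorClass : ∀ {k t δ} (P : Fin k → Bool) (π : Fin k → Fin t) →
                        count P < t * δ → ∃ λ c → count (P ∩ colorClass π c) < δ
pigeonhole-colorClass {δ = δ} P π few with any? (λ c → count (P ∩ colorClass π c) <? δ)
... | yes sparse = sparse
... | no ¬sparse = contradiction (count-≥-classes P π (λ c → ≮⇒≥ (λ lt → ¬sparse (c , lt)))) (<⇒≱ few)

sum-tabulate : ∀ {k} (f : Fin k → ℕ) → sumᴸ (tabulate f) ≡ sum f
sum-tabulate {zero} f = refl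
sum-tabulate {suc k} f = cong (f zero +_) (sum-tabulate (f ∘ suc))

degree≡count : ∀ {m} (G : Graph m) v → degree G v ≡ count (adj G v)
degree≡count G v =
  trans (cong sumᴸ (map-tabulate id (fromBool ∘ adj G v))) (sum-tabulate (fromBool ∘ adj G v))

adj⇒≢ : ∀ {m} (G : Graph m) {u v} → adj G u v ≡ true → u ≢ v
adj⇒≢ G {u} e refl = contradiction (trans (sym e) (irrefl G u)) λ ()

degree-complement : ∀ {n} (H : Graph n) v → count (adj (complement H) v) + count (adj H v) ≡ n ∸ 1
degree-complement {n} H v = begin
  count (adj H̄ v) + count (adj H v)          ≡⟨ m+n∸n≡m _ 1 ⟨
  count (adj H̄ v) + count (adj H v) + 1 ∸ 1  ≡⟨ cong (_∸ 1) with-v ⟩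
  n ∸ 1                                      ∎
  where
  open ≡-Reasoning
  H̄ = complement H
  exactlyOne : ∀ u → fromBool (adj H̄ v u) + fromBool (adj H v u) + fromBool (does (v ≟ u)) ≡ 1
  exactlyOne u with v ≟ u
  ... | yes refl rewrite irrefl H v = refl
  ... | no _ with adj H v u
  ...   | true = refl
  ...   | false = refl
  with-v : count (adj H̄ v) + count (adj H v) + 1 ≡ n
  with-v = begin
    count (adj H̄ v) + count (adj H v) + 1
      ≡⟨ cong (count (adj H̄ v) + count (adj H v) +_) (count-single v) ⟨
    count (adj H̄ v) + count (adj H v) + count (λ u → does (v ≟ u))
      ≡⟨ cong (_+ count (λ u → does (v ≟ u))) (∑-distrib-+ (fromBool ∘ adj H̄ v) (fromBool ∘ adj H v)) ⟨
    ∑[ u < n ] (fromBool (adj H̄ v u) + fromBool (adj H v u)) + count (λ u → does (v ≟ u))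
      ≡⟨ ∑-distrib-+ _ (λ u → fromBool (does (v ≟ u))) ⟨
    ∑[ u < n ] (fromBool (adj H̄ v u) + fromBool (adj H v u) + fromBool (does (v ≟ u)))
      ≡⟨ sum-cong-≗ exactlyOne ⟩
    count {n} (const true)
      ≡⟨ count-true n ⟩
    n ∎

-- Greedy colouring along a ranking

module Degeneracy {n r} (F : Graph n) (rank : Fin n → Fin r) (rank-injective : Injective _≡_ _≡_ rank) where

  _≺_ : Fin n → Fin n → Bool
  u ≺ v = toℕ (rank u) <ᵇ toℕ (rank v)

  earlierNeighbours : Fin n → Fin n → Bool
  earlierNeighbours v u = adj F v u ∧ u ≺ v

  earlier⇒< : ∀ {v u} → earlierNeighbours v u ≡ true → toℕ (rank u) < toℕ (rank v)
  earlier⇒< {v} {u} e = <ᵇ⇒< _ _ (Equivalence.from T-≡ (∧-conicalʳ (adj F v u) _ e))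

  Sparse : ∀ {t} → ℕ → (Fin n → Fin t) → Set
  Sparse δ π = ∀ v → count (earlierNeighbours v ∩ colorClass π (π v)) < δ

  -- The vertex of a copy of G with the largest rank has all its G-neighbours among its
  -- earlier neighbours of the same colour.
  sparse⇒GFree : ∀ {m t δ} (G : Graph (suc m)) → (∀ u → δ ≤ count (adj G u)) →
                 (π : Fin n → Fin t) → Sparse δ π → GFreeColoring G F t π
  sparse⇒GFree {m} G δ≤deg π sparse c (f , f-inj , f-adj , f-c) =
    <⇒≱ (sparse (f top)) (≤-trans (δ≤deg top) (count-injective f f-inj into))
    where
    top : Fin (suc m)
    top = argmax (toℕ ∘ rank ∘ f) zero (allFin (suc m))
    top-max : ∀ u → toℕ (rank (f u)) ≤ toℕ (rank (f top))
    top-max u = All.lookup (f[xs]≤f[argmax] {f = toℕ ∘ rank ∘ f} zero (allFin (suc m))) (∈-allFin u)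
    into : ∀ u → adj G top u ≡ true → (earlierNeighbours (f top) ∩ colorClass π (π (f top))) (f u) ≡ true
    into u e = ∧-intro (∧-intro (f-adj top u e) (Equivalence.to T-≡ (<⇒<ᵇ earlier)))
                       (dec-true (π (f u) ≟ π (f top)) (trans (f-c u) (sym (f-c top))))
      where
      earlier : toℕ (rank (f u)) < toℕ (rank (f top))
      earlier = ≤∧≢⇒< (top-max u) (λ eq → adj⇒≢ G e (sym (f-inj (rank-injective (toℕ-injective eq)))))

  -- Colour the vertices in order of rank, each with a colour that is rare among its
  -- earlier neighbours; colouring a vertex does not change the counts of earlier ones.
  greedy-upTo : ∀ {t δ} → (∀ v → count (earlierNeighbours v) < suc t * δ) →
                ∀ N → Σ (Fin n → Fin (suc t)) λ π →
                  ∀ v → toℕ (rank v) < N → count (earlierNeighbours v ∩ colorClass π (π v)) < δ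
  greedy-upTo few zero = const zero , λ _ ()
  greedy-upTo {δ = δ} few (suc N) with greedy-upTo few N | any? (λ v → toℕ (rank v) ≟ℕ N)
  ... | π , sparse | no unranked =
    π , λ v v<1+N → sparse v (≤∧≢⇒< (≤-pred v<1+N) (λ eq → unranked (v , eq)))
  ... | π , sparse | yes (v , v≡N) with pigeonhole-colorClass (earlierNeighbours v) π (few v)
  ...   | c , c-rare = π′ , sparse′
    where
    π′ = updateAt π v (const c)
    π≡π′-below : ∀ c u → toℕ (rank u) < N → colorClass π c u ≡ colorClass π′ c u
    π≡π′-below c u u<N = cong (λ x → does (x ≟ c))
      (sym (updateAt-minimal u v π (λ { refl → <-irrefl v≡N u<N })))
    sparse′ : ∀ w → toℕ (rank w) < suc N → count (earlierNeighbours w ∩ colorClass π′ (π′ w)) < δ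
    sparse′ w w<1+N with w ≟ v
    ... | yes refl = subst (_< δ)
          (trans (count-∩-cong (λ u e → π≡π′-below c u (subst (_ <_) v≡N (earlier⇒< e))))
                 (cong (λ x → count (earlierNeighbours v ∩ colorClass π′ x)) (sym (updateAt-updates v π))))
          c-rare
    ... | no w≢v = subst (_< δ)
          (trans (count-∩-cong (λ u e → π≡π′-below (π w) u (<-trans (earlier⇒< e) w<N)))
                 (cong (λ x → count (earlierNeighbours w ∩ colorClass π′ x)) (sym (updateAt-minimal w v π w≢v))))
          (sparse w w<N)
      where
      w<N : toℕ (rank w) < N
      w<N = ≤∧≢⇒< (≤-pred w<1+N) (λ eq → w≢v (rank-injective (toℕ-injective (trans eq (sym v≡N)))))

  degenerate⇒colorable : ∀ {m t δ} (G : Graph (suc m)) → (∀ u → δ ≤ count (adj G u)) →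
                         (∀ v → count (earlierNeighbours v) < suc t * δ) → Colorable G F (suc t)
  degenerate⇒colorable G δ≤deg few with greedy-upTo few r
  ... | π , sparse = π , sparse⇒GFree G δ≤deg π (λ v → sparse v (toℕ<n (rank v)))

-- Vertex-critical sets

module _ {m n} (G : Graph m) (H : Graph n) where

  ColorableOn : (Fin n → Bool) → ℕ → Set
  ColorableOn S k = Σ (Fin n → Fin k) λ π → ∀ c → ¬ CopyIn G H (λ v → S v ≡ true × π v ≡ c)

  ColorableOn-⊆ : ∀ {S S′ k} → S′ ⊆ S → ColorableOn S k → ColorableOn S′ k
  ColorableOn-⊆ S′⊆S (π , free) = π , λ c (f , f-inj , f-adj , f-in) →
    free c (f , f-inj , f-adj , λ u → S′⊆S (f u) (proj₁ (f-in u)) , proj₂ (f-in u))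

  ColorableOn-all : ∀ {k} → ColorableOn (const true) k → Colorable G H k
  ColorableOn-all (π , free) = π , λ c (f , f-inj , f-adj , f-c) → free c (f , f-inj , f-adj , λ u → refl , f-c u)

  VertexCritical : ℕ → (Fin n → Bool) → Set
  VertexCritical k S = ¬ ColorableOn S k × (∀ v → S v ≡ true → ColorableOn (S ─ v) k)

  -- Remove the vertices of vs one at a time whenever that keeps S uncolourable; each
  -- removal is a (classically) decided step, hence the double negation.
  critical-below : ∀ {k} (vs : List (Fin n)) S → ¬ ColorableOn S k →
    ¬ ¬ ∃ λ S′ → S′ ⊆ S × ¬ ColorableOn S′ k ×
                 (∀ v → v ∈ vs → S′ v ≡ true → ColorableOn (S′ ─ v) k)
  critical-below [] S ¬col found = found (S , (λ _ e → e) , ¬col , λ _ ())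
  critical-below (v ∷ vs) S ¬col found = ¬¬-excluded-middle λ where
    (yes col) → critical-below vs S ¬col λ (S′ , S′⊆S , ¬col′ , crit) →
      found (S′ , S′⊆S , ¬col′ , λ where
        _ (here refl) _ → ColorableOn-⊆ (─-mono v S′⊆S) col
        w (there w∈vs) → crit w w∈vs)
    (no ¬col-v) → critical-below vs (S ─ v) ¬col-v λ (S′ , S′⊆S-v , ¬col′ , crit) →
      found (S′ , (λ u → ─-⊆ S v u ∘ S′⊆S-v u) , ¬col′ , λ where
        _ (here refl) S′v → contradiction (trans (sym (S′⊆S-v v S′v)) (─-self S v)) λ ()
        w (there w∈vs) → crit w w∈vs)

  ∃-vertexCritical : ∀ {k} S → ¬ ColorableOn S k → ¬ ¬ ∃ (VertexCritical k)
  ∃-vertexCritical S ¬col =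
    ¬¬-map (λ (S′ , _ , ¬col′ , crit) → S′ , ¬col′ , λ v → crit v (∈-allFin v))
           (critical-below (allFin n) S ¬col)

  module _ {δ} (δ≤deg : ∀ u → δ ≤ count (adj G u)) where

    -- A copy of G in the new colour class c must use v, whose G-neighbours in the copy are
    -- then at least δ neighbours of v in S with colour c.
    recolor-free : ∀ {k S v c} (π : Fin n → Fin k) →
      (∀ c′ → ¬ CopyIn G H (λ w → (S ─ v) w ≡ true × π w ≡ c′)) →
      count (adj H v ∩ S ∩ colorClass π c) < δ →
      ∀ c′ → ¬ CopyIn G H (λ w → S w ≡ true × updateAt π v (const c) w ≡ c′)
    recolor-free {S = S} {v} {c} π free rare c′ (f , f-inj , f-adj , f-in) with any? (λ u → f u ≟ v)
    ... | no v∉f = free c′ (f , f-inj , f-adj , λ u →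
          ─-true {P = S} (proj₁ (f-in u)) (λ v≡fu → v∉f (u , sym v≡fu)) ,
          trans (sym (updateAt-minimal (f u) v π (λ fu≡v → v∉f (u , fu≡v)))) (proj₂ (f-in u)))
    ... | yes (u₀ , fu₀≡v) = <⇒≱ rare (≤-trans (δ≤deg u₀) (count-injective f f-inj into))
      where
      c′≡c : c′ ≡ c
      c′≡c = trans (sym (proj₂ (f-in u₀)))
                   (trans (cong (updateAt π v (const c)) fu₀≡v) (updateAt-updates v π))
      into : ∀ u → adj G u₀ u ≡ true → (adj H v ∩ S ∩ colorClass π c) (f u) ≡ true
      into u e = ∧-intro (∧-intro (subst (λ x → adj H x (f u) ≡ true) fu₀≡v (f-adj u₀ u e)) (proj₁ (f-in u)))
                         (dec-true (π (f u) ≟ c) πfu≡c)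
        where
        fu≢v : f u ≢ v
        fu≢v eq = adj⇒≢ G e (f-inj (trans fu₀≡v (sym eq)))
        πfu≡c : π (f u) ≡ c
        πfu≡c = trans (sym (updateAt-minimal (f u) v π fu≢v)) (trans (proj₂ (f-in u)) c′≡c)

    vertexCritical-degree : ∀ {k S} → VertexCritical k S → ∀ v → S v ≡ true → k * δ ≤ count (adj H v ∩ S)
    vertexCritical-degree {S = S} (¬col , crit) v Sv with crit v Sv
    ... | π , free = count-≥-classes (adj H v ∩ S) π λ c →
          ≮⇒≥ λ rare → ¬col (updateAt π v (const c) , recolor-free π free rare)

vertexCritical-size : ∀ {m n δ k} (G : Graph (suc m)) (H : Graph n) → (∀ u → δ ≤ count (adj G u)) →
                      ∀ {S} → VertexCritical G H (suc k) S → suc (suc k * δ) ≤ count S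
vertexCritical-size {δ = δ} {k} G H δ≤deg {S} crit@(¬col , _) with any? (λ v → S v ≟ᵇ true)
... | no empty = contradiction (const zero , λ c (f , _ , _ , f-in) → empty (f zero , proj₁ (f-in zero))) ¬col
... | yes (v , Sv) = begin
  suc (suc k * δ)          ≤⟨ s≤s (vertexCritical-degree G H δ≤deg crit v Sv) ⟩
  suc (count (adj H v ∩ S)) ≤⟨ s≤s (count-mono inS-v) ⟩
  suc (count (S ─ v))       ≡⟨ count-remove S Sv ⟨
  count S                   ∎
  where
  open ≤-Reasoning
  inS-v : adj H v ∩ S ⊆ S ─ v
  inS-v u e = ─-true {P = S} (∧-conicalʳ (adj H v u) (S u) e) (adj⇒≢ H (∧-conicalˡ (adj H v u) (S u) e))

HighDegreeSet : ∀ {n} → Graph n → ℕ → (Fin n → Bool) → Set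
HighDegreeSet H ℓ S = suc ℓ ≤ count S × (∀ v → S v ≡ true → ℓ ≤ count (adj H v))

uncolorable⇒highDegreeSet : ∀ {m n δ} (G : Graph (suc m)) (H : Graph (suc n)) → (∀ u → δ ≤ count (adj G u)) →
                            ∀ k → ¬ Colorable G H k → ¬ ¬ ∃ (HighDegreeSet H (k * δ))
uncolorable⇒highDegreeSet {n = n} G H δ≤deg zero _ found =
  found (const true , subst (1 ≤_) (sym (count-true (suc n))) (s≤s z≤n) , λ _ _ → z≤n)
uncolorable⇒highDegreeSet {δ = δ} G H δ≤deg (suc k) ¬col =
  ¬¬-map highDegree (∃-vertexCritical G H (const true) (¬col ∘ ColorableOn-all G H))
  where
  highDegree : ∃ (VertexCritical G H (suc k)) → ∃ (HighDegreeSet H (suc k * δ))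
  highDegree (S , crit) = S , vertexCritical-size G H δ≤deg crit , λ v Sv →
    ≤-trans (vertexCritical-degree G H δ≤deg crit v Sv)
            (count-mono {P = adj H v ∩ S} (λ u → ∧-conicalˡ (adj H v u) (S u)))

rankLast : ∀ {k} → (Fin k → Bool) → Fin k → Fin (k + k)
rankLast {k} S u = if S u then k ↑ʳ u else u ↑ˡ k

↑ˡ<↑ʳ : ∀ {k} (u v : Fin k) → toℕ (u ↑ˡ k) < toℕ (k ↑ʳ v)
↑ˡ<↑ʳ {k} u v = begin-strict
  toℕ (u ↑ˡ k) ≡⟨ toℕ-↑ˡ u k ⟩
  toℕ u        <⟨ toℕ<n u ⟩
  k            ≤⟨ m≤m+n k (toℕ v) ⟩
  k + toℕ v    ≡⟨ toℕ-↑ʳ k v ⟨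
  toℕ (k ↑ʳ v) ∎
  where open ≤-Reasoning

rankLast-injective : ∀ {k} (S : Fin k → Bool) → Injective _≡_ _≡_ (rankLast S)
rankLast-injective {k} S {x} {y} with S x | S y
... | true | true = ↑ʳ-injective k x y
... | false | false = ↑ˡ-injective k x y
... | true | false = λ eq → contradiction (cong toℕ (sym eq)) (<⇒≢ (↑ˡ<↑ʳ y x))
... | false | true = λ eq → contradiction (cong toℕ eq) (<⇒≢ (↑ˡ<↑ʳ x y))

rankLast-outside<inside : ∀ {k} (S : Fin k → Bool) {u v} → S u ≡ false → S v ≡ true →
                          toℕ (rankLast S u) < toℕ (rankLast S v)
rankLast-outside<inside S {u} {v} Su Sv rewrite Su | Sv = ↑ˡ<↑ʳ u v

-- Every vertex has at most n - 1 - ℓ earlier neighbours in the complement: a vertex of S has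
-- at most that many neighbours at all, and the earlier neighbours of a vertex outside S lie
-- outside S.
complement-colorable : ∀ {m n d} (G : Graph (suc m)) (H : Graph (suc n)) → (∀ u → suc d ≤ count (adj G u)) →
                       ∀ {ℓ S} → HighDegreeSet H ℓ S → Colorable G (complement H) (suc ((n ∸ ℓ) / suc d))
complement-colorable {n = n} {d} G H δ≤deg {ℓ} {S} (large , highDegree) = degenerate⇒colorable G δ≤deg few
  where
  open Degeneracy (complement H) (rankLast S) (rankLast-injective S)
  earlier+ℓ≤ : ∀ v b → S v ≡ b → count (earlierNeighbours v) + ℓ ≤ n
  earlier+ℓ≤ v true Sv = begin
    count (earlierNeighbours v) + ℓ                 ≤⟨ +-mono-≤ (count-mono earlier⊆adj) (highDegree v Sv) ⟩
    count (adj (complement H) v) + count (adj H v)  ≡⟨ degree-complement H v ⟩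
    n                                               ∎
    where
    open ≤-Reasoning
    earlier⊆adj : earlierNeighbours v ⊆ adj (complement H) v
    earlier⊆adj u = ∧-conicalˡ (adj (complement H) v u) (u ≺ v)
  earlier+ℓ≤ v false Sv = ≤-pred (begin
    suc (count (earlierNeighbours v) + ℓ) ≡⟨ +-suc _ ℓ ⟨
    count (earlierNeighbours v) + suc ℓ   ≤⟨ +-mono-≤ (count-mono outside) large ⟩
    count (not ∘ S) + count S             ≡⟨ count-not S ⟩
    suc n                                 ∎)
    where
    open ≤-Reasoning
    outside : earlierNeighbours v ⊆ not ∘ S
    outside u e = sym (¬-not λ true≡Su →
      contradiction (earlier⇒< e) (<⇒≯ (rankLast-outside<inside S Sv (sym true≡Su))))
  few : ∀ v → count (earlierNeighbours v) < suc ((n ∸ ℓ) / suc d) * suc d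
  few v = ≤-<-trans (m+n≤o⇒m≤o∸n _ (earlier+ℓ≤ v (S v) refl)) (m<[1+m/n]*n (n ∸ ℓ) (suc d))
    where
    m<[1+m/n]*n : ∀ a b .{{_ : NonZero b}} → a < suc (a / b) * b
    m<[1+m/n]*n a b = begin-strict
      a                 ≡⟨ m≡m%n+[m/n]*n a b ⟩
      a % b + a / b * b <⟨ +-monoˡ-< (a / b * b) (m%n<n a b) ⟩
      b + a / b * b     ∎
      where open ≤-Reasoning

ceilDiv-suc : ∀ n d → ceilDiv (suc n) (suc d) ≡ suc (n / suc d)
ceilDiv-suc n d = trans (m/n≡1+[m∸n]/n {suc n + d} {suc d} (s≤s (m≤n+m d n)))
                        (cong (λ x → suc (x / suc d)) (m+n∸n≡m n d))

χ-sum-bound : ∀ {m n d} (G : Graph (suc m)) (H : Graph (suc n)) → (∀ u → suc d ≤ count (adj G u)) →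
              ∀ {k₁ k₂} → IsChi G H k₁ → IsChi G (complement H) k₂ → k₁ + k₂ ≤ suc (suc (n / suc d))
χ-sum-bound G H δ≤deg {zero} ((π , _) , _) _ = contradiction (π zero) λ ()
χ-sum-bound {n = n} {d} G H δ≤deg {suc k} {k₂} (_ , minimal₁) (_ , minimal₂) =
  decidable-stable (_ ≤? _) (¬¬-map bound (uncolorable⇒highDegreeSet G H δ≤deg k (minimal₁ k ≤-refl)))
  where
  bound : ∃ (HighDegreeSet H (k * suc d)) → suc k + k₂ ≤ suc (suc (n / suc d))
  bound (S , high@(large , _)) = begin
    suc k + k₂                             ≤⟨ +-monoʳ-≤ (suc k) k₂≤ ⟩
    suc k + suc ((n ∸ k * suc d) / suc d)  ≡⟨ cong (λ x → suc k + suc x) ([m∸n*o]/o≡m/o∸n n k (suc d)) ⟩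
    suc k + suc (n / suc d ∸ k)            ≡⟨ cong suc (trans (+-suc k _) (cong suc (m+[n∸m]≡n k≤n/δ))) ⟩
    suc (suc (n / suc d))                  ∎
    where
    open ≤-Reasoning
    k₂≤ : k₂ ≤ suc ((n ∸ k * suc d) / suc d)
    k₂≤ = ≮⇒≥ λ lt → minimal₂ _ lt (complement-colorable G H δ≤deg high)
    k≤n/δ : k ≤ n / suc d
    k≤n/δ = subst (_≤ n / suc d) (m*n/n≡m k (suc d))
                  (/-monoˡ-≤ (suc d) (≤-pred (≤-trans large (count-≤ S))))

IsChi-emptyGraph : ∀ {m} {G : Graph m} {H : Graph 0} {k} → IsChi G H k → k ≡ 0
IsChi-emptyGraph {k = zero} _ = refl
IsChi-emptyGraph {k = suc k} (_ , minimal) = contradiction ((λ ()) , λ ()) (minimal 0 (s≤s z≤n))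

sum-bound : (m n δ : ℕ) (G : Graph m) (H : Graph n) → Hyp G H δ →
            ∀ k₁ k₂ → IsChi G H k₁ → IsChi G (complement H) k₂ → k₁ + k₂ ≤ ceilDiv n δ + 1
sum-bound .(suc (suc _)) zero .(suc _) G H (s≤s (s≤s z≤n) , _ , s≤s z≤n , _) k₁ k₂ χ₁ χ₂
  rewrite IsChi-emptyGraph {G = G} {H} χ₁ | IsChi-emptyGraph {G = G} {complement H} χ₂ = z≤n
sum-bound .(suc (suc _)) (suc n) .(suc d) G H
          (s≤s (s≤s z≤n) , (_ , δ≤deg) , s≤s {n = d} z≤n , _) k₁ k₂ χ₁ χ₂ =
  subst (k₁ + k₂ ≤_) (trans (cong suc (sym (ceilDiv-suc n d))) (+-comm 1 _))
        (χ-sum-bound G H (λ u → subst (suc d ≤_) (degree≡count G u) (δ≤deg u)) χ₁ χ₂)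

IsChi-fewerVertices : ∀ {m n} (G : Graph m) (H : Graph (suc n)) → suc n < m → IsChi G H 1
IsChi-fewerVertices G H fewer =
  (const zero , λ _ (f , f-inj , _) → let (i , j , i<j , fi≡fj) = pigeonhole fewer f
                                      in <⇒≢ i<j (cong toℕ (f-inj fi≡fj))) ,
  λ { zero _ (π , _) → contradiction (π zero) λ () ; (suc _) (s≤s ()) }

K₂-K₁-sharp : Σ ℕ (λ m → Σ ℕ (λ n → Σ ℕ (λ δ → Σ (Graph m) (λ G → Σ (Graph n) (λ H →
                Hyp G H δ × Σ ℕ (λ k₁ → Σ ℕ (λ k₂ →
                  IsChi G H k₁ × IsChi G (complement H) k₂ × k₁ + k₂ ≡ ceilDiv n δ + 1)))))))
K₂-K₁-sharp = 2 , 1 , 1 , complete 2 , complete 1 ,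
  (s≤s (s≤s z≤n) , ((zero , refl) , λ { zero → s≤s z≤n ; (suc zero) → s≤s z≤n }) , s≤s z≤n ,
    inj₁ ((id , id , (λ y → y , id) , λ _ _ → refl) , λ { (s≤s () , _) })) ,
  1 , 1 , IsChi-fewerVertices (complete 2) (complete 1) ≤-refl ,
  IsChi-fewerVertices (complete 2) (complement (complete 1)) ≤-refl , refl

theorem5 : ((m n δ : ℕ) (G : Graph m) (H : Graph n) → Hyp G H δ →
               ∀ k₁ k₂ → IsChi G H k₁ → IsChi G (complement H) k₂ →
               k₁ + k₂ ≤ ceilDiv n δ + 1)
             × Σ ℕ (λ m → Σ ℕ (λ n → Σ ℕ (λ δ → Σ (Graph m) (λ G → Σ (Graph n) (λ H →
                 Hyp G H δ × Σ ℕ (λ k₁ → Σ ℕ (λ k₂ →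
                   IsChi G H k₁ × IsChi G (complement H) k₂ × k₁ + k₂ ≡ ceilDiv n δ + 1)))))))
theorem5 = sum-bound , K₂-K₁-sharp
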